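{- Let $G$ be a graph on vertices $1,\dots,n$, and let $A=[a_{i,j}]\in\mathcal{S}(G)$ and $B=[b_{i,j}]\in\mathcal{S}(\overline{G})$ satisfy $AB=O$. Let $i,j$ be distinct vertices with $N_G(i)\subseteq N_G[j]$. Then: (1) if $i$ and $j$ are adjacent in $G$, then $b_{j,j}=0$; (2) if $i$ and $j$ are not adjacent in $G$, then $a_{i,i}=0$.
   Context: For a graph $G$ with vertex set $\{1,\dots,n\}$, $\mathcal{S}(G)$ is the set of real symmetric $n\times n$ matrices $A=[a_{i,j}]$ such that for $i\neq j$, $a_{i,j}\neq 0$ if and only if $ij\in E(G)$ (diagonal entries are unrestricted). $\overline{G}$ is the complement of $G$. $N_G(v)$ is the open neighborhood of $v$ in $G$ and $N_G[v]=N_G(v)\cup\{v\}$ its closed neighborhood. -}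

module Defs where

open import Level using (Level; _⊔_) renaming (suc to lsuc)
open import Data.Nat.Base using (ℕ; zero; suc)
open import Data.Fin.Base using (Fin; zero; suc)
open import Data.Product.Base using (_×_)
open import Data.Sum.Base using (_⊎_)
open import Relation.Nullary using (¬_; Dec)
open import Relation.Binary.PropositionalEquality using (_≡_; _≢_)
open import Algebra.Apartness.Bundles using (HeytingField)

record Graph (n : ℕ) : Set₁ where
  field
    Adj    : Fin n → Fin n → Set
    sym    : ∀ {i j} → Adj i j → Adj j i
    irrefl : ∀ {i} → ¬ Adj i i
    dec    : ∀ i j → Dec (Adj i j)
open Graph public

complement : ∀ {n} → Graph n → Graph n
complement {n} G = record
  { Adj    = λ i j → (i ≢ j) × (¬ Adj G i j)
  ; sym    = λ { (i≢j , ¬a) → (λ e → i≢j (symm e)) , (λ a → ¬a (Graph.sym G a)) }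
  ; irrefl = λ { (i≢i , _) → i≢i Eq.refl }
  ; dec    = decC
  }
  where
  import Relation.Binary.PropositionalEquality as Eq
  open import Data.Product.Base using (_,_)
  open import Data.Fin.Properties using (_≟_)
  open import Relation.Nullary using (yes; no)
  symm = Eq.sym
  decC : ∀ i j → Dec ((i ≢ j) × (¬ Adj G i j))
  decC i j with i ≟ j | Graph.dec G i j
  ... | yes e | _     = no λ { (ne , _) → ne e }
  ... | no ne | yes a = no λ { (_ , na) → na a }
  ... | no ne | no na = yes (ne , na)

NbhdSub : ∀ {n} → Graph n → Fin n → Fin n → Set
NbhdSub G i j = ∀ k → Adj G i k → (k ≡ j) ⊎ Adj G j k

module _ {c ℓ₁ ℓ₂ : Level} (F : HeytingField c ℓ₁ ℓ₂) where
  open HeytingField F using (Carrier; _≈_; _+_; _*_; 0#)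

  Matrix : ℕ → Set c
  Matrix n = Fin n → Fin n → Carrier

  sumFin : ∀ n → (Fin n → Carrier) → Carrier
  sumFin zero    f = 0#
  sumFin (suc n) f = f zero + sumFin n (λ k → f (suc k))

  mul : ∀ {n} → Matrix n → Matrix n → Matrix n
  mul {n} A B i j = sumFin n (λ k → A i k * B k j)

  IsZeroMatrix : ∀ {n} → Matrix n → Set ℓ₁
  IsZeroMatrix M = ∀ i j → M i j ≈ 0#

  IsSymmetric : ∀ {n} → Matrix n → Set ℓ₁
  IsSymmetric M = ∀ i j → M i j ≈ M j i

  InS : ∀ {n} → Graph n → Matrix n → Set (ℓ₁)
  InS {n} G M = IsSymmetric M ×
    (∀ (i j : Fin n) → i ≢ j → (Adj G i j → ¬ (M i j ≈ 0#)) × (¬ Adj G i j → M i j ≈ 0#))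

{-# OPTIONS --safe #-}
-- Expand (AB)ᵢⱼ = Σₖ aᵢₖ bₖⱼ. For k ∉ {i, j} the term vanishes: either aᵢₖ = 0, or
-- k ∈ N(i) ⊆ N[j] makes k adjacent to j in G, so bₖⱼ = 0. Hence aᵢᵢ bᵢⱼ + aᵢⱼ bⱼⱼ = 0.
-- If i ~ j then bᵢⱼ = 0 and aᵢⱼ ≠ 0, forcing bⱼⱼ = 0; if i ≁ j then aᵢⱼ = 0 and
-- bᵢⱼ ≠ 0, forcing aᵢᵢ = 0.
module Submission where

open import Defs hiding (sym)
open import Level using (Level)
open import Data.Nat.Base using (ℕ; zero; suc)
open import Data.Fin.Base using (Fin; zero; suc)
open import Data.Fin.Properties using (_≟_; suc-injective)
open import Data.Product.Base using (_×_; _,_; proj₁; proj₂)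
open import Data.Sum.Base using (inj₁; inj₂)
open import Data.Empty using (⊥-elim)
open import Relation.Nullary using (¬_; yes; no)
open import Relation.Binary.PropositionalEquality using (_≢_; refl; ≢-sym)
open import Algebra.Apartness.Bundles using (HeytingField)
import Algebra.Apartness.Properties.HeytingCommutativeRing as HeytingCommutativeRingProperties

module FieldLemmas {c ℓ₁ ℓ₂ : Level} (F : HeytingField c ℓ₁ ℓ₂) where
  open HeytingField F hiding (zero) renaming (refl to ≈-refl)
  open HeytingCommutativeRingProperties heytingCommutativeRing using (x#0y#0→xy#0; #-congʳ)

  x≈0⇒xy≈0 : ∀ {x y} → x ≈ 0# → x * y ≈ 0#
  x≈0⇒xy≈0 {y = y} x≈0 = trans (*-congʳ x≈0) (zeroˡ y)

  y≈0⇒xy≈0 : ∀ {x y} → y ≈ 0# → x * y ≈ 0#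
  y≈0⇒xy≈0 {x = x} y≈0 = trans (*-congˡ y≈0) (zeroʳ x)

  ≉0⇒¬¬#0 : ∀ {x} → ¬ x ≈ 0# → ¬ ¬ x # 0#
  ≉0⇒¬¬#0 {x} x≉0 ¬x#0 = x≉0 (proj₁ (tight x 0#) ¬x#0)

  *-cancelˡ-≈0 : ∀ {x y} → ¬ x ≈ 0# → x * y ≈ 0# → y ≈ 0#
  *-cancelˡ-≈0 {x} {y} x≉0 xy≈0 = proj₁ (tight y 0#) λ y#0 →
    ≉0⇒¬¬#0 x≉0 λ x#0 → #-irrefl (≈-refl) (#-congʳ xy≈0 (x#0y#0→xy#0 x#0 y#0))

  *-cancelʳ-≈0 : ∀ {x y} → ¬ y ≈ 0# → x * y ≈ 0# → x ≈ 0#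
  *-cancelʳ-≈0 y≉0 xy≈0 = *-cancelˡ-≈0 y≉0 (trans (*-comm _ _) xy≈0)

  sumFin-zero : ∀ n (f : Fin n → Carrier) → (∀ k → f k ≈ 0#) → sumFin F n f ≈ 0#
  sumFin-zero zero    f f≈0 = ≈-refl
  sumFin-zero (suc n) f f≈0 =
    trans (+-cong (f≈0 zero) (sumFin-zero n (λ k → f (suc k)) (λ k → f≈0 (suc k))))
          (+-identityˡ 0#)

  sumFin-single : ∀ n (f : Fin n → Carrier) (m : Fin n) →
                  (∀ k → k ≢ m → f k ≈ 0#) → sumFin F n f ≈ f m
  sumFin-single (suc n) f zero f≈0 =
    trans (+-congˡ (sumFin-zero n (λ k → f (suc k)) (λ k → f≈0 (suc k) λ ())))
          (+-identityʳ (f zero))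
  sumFin-single (suc n) f (suc m) f≈0 =
    trans (+-congʳ (f≈0 zero λ ()))
          (trans (+-identityˡ _)
                 (sumFin-single n (λ k → f (suc k)) m
                    (λ k k≢m → f≈0 (suc k) (λ e → k≢m (suc-injective e)))))

module _ {c ℓ₁ ℓ₂ : Level} (F : HeytingField c ℓ₁ ℓ₂) {n : ℕ} (G : Graph n)
         {A B : Matrix F n} (A∈S : InS F G A) (B∈S : InS F (complement G) B)
         {i j : Fin n} (i≢j : i ≢ j) (N[i]⊆N[j] : NbhdSub G i j) where
  open HeytingField F hiding (zero; refl)
  open FieldLemmas F

  private
    A-nonzero : ∀ {k l} → k ≢ l → Adj G k l → ¬ A k l ≈ 0#
    A-nonzero k≢l = proj₁ (proj₂ A∈S _ _ k≢l)

    A-zero : ∀ {k l} → k ≢ l → ¬ Adj G k l → A k l ≈ 0#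
    A-zero k≢l = proj₂ (proj₂ A∈S _ _ k≢l)

    B-nonzero : ∀ {k l} → k ≢ l → ¬ Adj G k l → ¬ B k l ≈ 0#
    B-nonzero k≢l k≁l = proj₁ (proj₂ B∈S _ _ k≢l) (k≢l , k≁l)

    B-zero : ∀ {k l} → k ≢ l → Adj G k l → B k l ≈ 0#
    B-zero k≢l k~l = proj₂ (proj₂ B∈S _ _ k≢l) λ { (_ , k≁l) → k≁l k~l }

  AB-term-vanishes : ∀ k → k ≢ i → k ≢ j → A i k * B k j ≈ 0#
  AB-term-vanishes k k≢i k≢j with Graph.dec G i k
  ... | no  i≁k = x≈0⇒xy≈0 (A-zero (≢-sym k≢i) i≁k)
  ... | yes i~k with N[i]⊆N[j] k i~k
  ...   | inj₁ k≡j = ⊥-elim (k≢j k≡j)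
  ...   | inj₂ j~k = y≈0⇒xy≈0 (B-zero k≢j (Graph.sym G j~k))

  adjacent⇒Bjj≈0 : IsZeroMatrix F (mul F A B) → Adj G i j → B j j ≈ 0#
  adjacent⇒Bjj≈0 AB≈O i~j =
    *-cancelˡ-≈0 (A-nonzero i≢j i~j)
      (trans (sym (sumFin-single n (λ k → A i k * B k j) j other-terms)) (AB≈O i j))
    where
    other-terms : ∀ k → k ≢ j → A i k * B k j ≈ 0#
    other-terms k k≢j with k ≟ i
    ... | yes refl = y≈0⇒xy≈0 (B-zero i≢j i~j)
    ... | no  k≢i  = AB-term-vanishes k k≢i k≢j

  nonadjacent⇒Aii≈0 : IsZeroMatrix F (mul F A B) → ¬ Adj G i j → A i i ≈ 0#
  nonadjacent⇒Aii≈0 AB≈O i≁j =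
    *-cancelʳ-≈0 (B-nonzero i≢j i≁j)
      (trans (sym (sumFin-single n (λ k → A i k * B k j) i other-terms)) (AB≈O i j))
    where
    other-terms : ∀ k → k ≢ i → A i k * B k j ≈ 0#
    other-terms k k≢i with k ≟ j
    ... | yes refl = x≈0⇒xy≈0 (A-zero i≢j i≁j)
    ... | no  k≢j  = AB-term-vanishes k k≢i k≢j

lemma2p3 : ∀ {c ℓ₁ ℓ₂ : Level} (F : HeytingField c ℓ₁ ℓ₂) (n : ℕ) (G : Graph n)
    (A B : Matrix F n) → InS F G A → InS F (complement G) B
    → IsZeroMatrix F (mul F A B)
    → (i j : Fin n) → i ≢ j → NbhdSub G i j
    → (Adj G i j → HeytingField._≈_ F (B j j) (HeytingField.0# F))
      × (¬ Adj G i j → HeytingField._≈_ F (A i i) (HeytingField.0# F))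
lemma2p3 F n G A B A∈S B∈S AB≈O i j i≢j N[i]⊆N[j] =
    adjacent⇒Bjj≈0 F G A∈S B∈S i≢j N[i]⊆N[j] AB≈O
  , nonadjacent⇒Aii≈0 F G A∈S B∈S i≢j N[i]⊆N[j] AB≈O
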